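{- Let $n\ge 5$, let $v_0,\dots,v_{n-1}$ be points in convex position labeled in cyclic order (indices mod $n$), and let $G$ be a geometric graph on these points whose only span-2 edges are two consecutive ones, $e_i=v_{i-1}v_{i+1}$ and $e_{i+1}=v_iv_{i+2}$. Then $G$ has no triangulation. Equivalently, $T(K_{n,-(n-2)})=0$.
   Context: A geometric graph on a convex point set is a set of straight-line segments between the points. A triangulation of $G$ is a triangulation of the convex polygon $v_0\cdots v_{n-1}$ (a maximal set of pairwise non-crossing diagonals) all of whose diagonals are edges of $G$; $T(G)$ denotes the number of triangulations of $G$. A span-2 edge is a segment $e_j=v_{j-1}v_{j+1}$. For $0\le m\le n$, $K_{n,-m}$ denotes the complete convex geometric graph on $v_0,\dots,v_{n-1}$ from which $m$ consecutive span-2 edges $e_i,e_{i+1},\dots,e_{i+m-1}$ have been removed (all choices of $i$ give isomorphic graphs under rotation). -}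

module Defs where

open import Data.Nat using (ℕ; suc; _+_; _*_; _∸_; _<_)
open import Data.Fin using (Fin; toℕ)
open import Data.Bool using (Bool; true)
open import Data.Product using (Σ; _×_)
open import Data.Sum using (_⊎_)
open import Relation.Nullary using (¬_)
open import Relation.Binary.PropositionalEquality using (_≡_; _≢_)

-- Vertices of the convex polygon are v_0 … v_{n-1}, represented by Fin n,
-- labelled in cyclic (convex-position) order.

-- IsV n a k : the vertex a is v_k, indices taken mod n (k ≡ toℕ a mod n).
IsV : (n : ℕ) → Fin n → ℕ → Set
IsV n a k = Σ ℕ λ q → k ≡ toℕ a + q * n

record GeomGraph (n : ℕ) : Set where
  field
    adj : Fin n → Fin n → Bool
    adj-sym : ∀ a b → adj a b ≡ adj b a

Edge : {n : ℕ} → GeomGraph n → Fin n → Fin n → Set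
Edge G a b = GeomGraph.adj G a b ≡ true

-- The segment {a,b} is the span-2 edge e_j = v_{j-1} v_{j+1}
-- (v_{j-1} is written v_{j+n-1}, indices mod n).
IsSpan2 : (n : ℕ) → Fin n → Fin n → ℕ → Set
IsSpan2 n a b j =
  (IsV n a (j + (n ∸ 1)) × IsV n b (suc j)) ⊎ (IsV n b (j + (n ∸ 1)) × IsV n a (suc j))

IsSide : (n : ℕ) → Fin n → Fin n → Set
IsSide n a b = Σ (Fin n) λ j →
  (IsV n a (toℕ j) × IsV n b (suc (toℕ j))) ⊎ (IsV n b (toℕ j) × IsV n a (suc (toℕ j)))

Diagonal : (n : ℕ) → Fin n → Fin n → Set
Diagonal n a b = a ≢ b × ¬ IsSide n a b

-- Inside a b x : x lies strictly inside the boundary arc going from a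
-- to b in the cyclic (increasing-label) direction.
Inside : {n : ℕ} → Fin n → Fin n → Fin n → Set
Inside a b x =
  (toℕ a < toℕ b × (toℕ a < toℕ x × toℕ x < toℕ b))
  ⊎ (toℕ b < toℕ a × (toℕ a < toℕ x ⊎ toℕ x < toℕ b))

-- Segments ab and cd cross (in their relative interiors): for points in
-- convex position this happens iff their endpoints strictly interleave.
Cross : {n : ℕ} → Fin n → Fin n → Fin n → Fin n → Set
Cross a b c d = (Inside a b c × Inside b a d) ⊎ (Inside b a c × Inside a b d)

record Triangulation {n : ℕ} (G : GeomGraph n) : Set where
  field
    diag : Fin n → Fin n → Bool
    diag-sym : ∀ a b → diag a b ≡ diag b a
    isDiagonal : ∀ a b → diag a b ≡ true → Diagonal n a b
    nonCrossing : ∀ a b c d → diag a b ≡ true → diag c d ≡ true → ¬ Cross a b c d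
    maximal : ∀ a b → Diagonal n a b →
      (∀ c d → diag c d ≡ true → ¬ Cross a b c d) → diag a b ≡ true
    inG : ∀ a b → diag a b ≡ true → Edge G a b

module Submission where

-- Rotate the labels so that the two permitted span-2 edges
-- e_i, e_{i+1} become the chords {m-1, 0} and {m, 1} (n = m + 1): these are
-- exactly the span-2 chords that "wrap around" the label m -> 0.  Read in
-- the rotated labels 0,...,m, a triangulation is a maximal non-crossing
-- set of diagonals, and such a set always has an ear {j, j+2} with
-- j + 2 <= m strictly inside the side {0, m} (ear lemma, proved by
-- shrinking an uncrossed chord).  For n >= 5 that ear is a span-2 edge
-- e_t with t different from i and i+1, so it is not an edge of G.

open import Defs
open import Data.Nat using (ℕ; zero; suc; _+_; _*_; _≤_; _<_; _/_; _%_; z≤n; s≤s; z<s; s<s; s<s⁻¹)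
open import Data.Nat.Properties
  using (<-trans; <-irrefl; <-asym; ≤-trans; ≤-refl; ≤-pred; ≤-reflexive; <⇒≤; n≤1+n;
         m≤n⇒m<n∨m≡n; m≤m+n; +-comm; +-suc; +-monoʳ-≤)
open import Data.Nat.DivMod
  using (_mod_; %-distribˡ-+; m%n%n≡m%n; [m+n]%n≡m%n; [m+kn]%n≡m%n; m≡m%n+[m/n]*n;
         m<n⇒m%n≡m; n%n≡0; m%n<n)
open import Data.Fin using (Fin; toℕ; fromℕ<)
open import Data.Fin.Properties using (toℕ<n; toℕ-fromℕ<; toℕ-injective)
open import Data.Bool using (true)
open import Data.Product using (Σ; _×_; _,_)
open import Data.Product.Function.NonDependent.Propositional using (_×-⇔_)
open import Data.Sum using (_⊎_; inj₁; inj₂)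
open import Data.Sum.Function.Propositional using (_⊎-⇔_)
open import Data.Empty using (⊥; ⊥-elim)
open import Function.Base using (_∘_)
open import Function.Bundles using (_⇔_; mk⇔; Equivalence)
open import Function.Properties.Equivalence using () renaming (refl to ⇔-refl; sym to ⇔-sym; trans to ⇔-trans)
open import Relation.Nullary using (¬_)
open import Relation.Binary.PropositionalEquality
  using (_≡_; _≢_; refl; sym; trans; cong; subst; subst₂; module ≡-Reasoning)

InsideN : ℕ → ℕ → ℕ → Set
InsideN a b x = (a < b × (a < x × x < b)) ⊎ (b < a × (a < x ⊎ x < b))

CrossN : ℕ → ℕ → ℕ → ℕ → Set
CrossN a b c d = (InsideN a b c × InsideN b a d) ⊎ (InsideN b a c × InsideN a b d)

-- It lets every case of the successor lemma below be reduced
-- to one where the wrapping label comes first.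
inside-cycle : ∀ {a b x} → InsideN a b x → InsideN x a b
inside-cycle (inj₁ (_ , a<x , x<b)) = inj₂ (a<x , inj₁ x<b)
inside-cycle (inj₂ (b<a , inj₁ a<x)) = inj₂ (a<x , inj₂ b<a)
inside-cycle (inj₂ (b<a , inj₂ x<b)) = inj₁ (<-trans x<b b<a , x<b , b<a)

inside-cycle⇔ : ∀ {a b x} → InsideN a b x ⇔ InsideN x a b
inside-cycle⇔ = mk⇔ inside-cycle (inside-cycle ∘ inside-cycle)

inside-cycle²⇔ : ∀ {a b x} → InsideN a b x ⇔ InsideN b x a
inside-cycle²⇔ = ⇔-trans inside-cycle⇔ inside-cycle⇔

inside-empty : ∀ {a x} → ¬ InsideN a a x
inside-empty (inj₁ (a<a , _)) = <-irrefl refl a<a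
inside-empty (inj₂ (a<a , _)) = <-irrefl refl a<a

nothing-after-last : ∀ {m x} → x ≤ m → ¬ InsideN m 0 x
nothing-after-last x≤m (inj₂ (_ , inj₁ m<x)) = <-irrefl refl (≤-trans m<x x≤m)

inside-shift : ∀ {a b x} → InsideN a b x ⇔ InsideN (suc a) (suc b) (suc x)
inside-shift = mk⇔ up down
  where
  up : ∀ {a b x} → InsideN a b x → InsideN (suc a) (suc b) (suc x)
  up (inj₁ (p , q , r)) = inj₁ (s<s p , s<s q , s<s r)
  up (inj₂ (p , inj₁ q)) = inj₂ (s<s p , inj₁ (s<s q))
  up (inj₂ (p , inj₂ q)) = inj₂ (s<s p , inj₂ (s<s q))
  down : ∀ {a b x} → InsideN (suc a) (suc b) (suc x) → InsideN a b x
  down (inj₁ (p , q , r)) = inj₁ (s<s⁻¹ p , s<s⁻¹ q , s<s⁻¹ r)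
  down (inj₂ (p , inj₁ q)) = inj₂ (s<s⁻¹ p , inj₁ (s<s⁻¹ q))
  down (inj₂ (p , inj₂ q)) = inj₂ (s<s⁻¹ p , inj₂ (s<s⁻¹ q))

inside-wrap : ∀ {m b x} → x < m → b < m → InsideN m b x ⇔ InsideN 0 (suc b) (suc x)
inside-wrap {m} {b} {x} x<m b<m = mk⇔ to from
  where
  to : InsideN m b x → InsideN 0 (suc b) (suc x)
  to (inj₁ (m<b , _)) = ⊥-elim (<-asym m<b b<m)
  to (inj₂ (_ , inj₁ m<x)) = ⊥-elim (<-asym m<x x<m)
  to (inj₂ (_ , inj₂ x<b)) = inj₁ (z<s , z<s , s<s x<b)
  from : InsideN 0 (suc b) (suc x) → InsideN m b x
  from (inj₁ (_ , _ , x<b)) = inj₂ (b<m , inj₂ (s<s⁻¹ x<b))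

both-absurd : ∀ {A B : Set} → ¬ A → ¬ B → A ⇔ B
both-absurd ¬a ¬b = mk⇔ (⊥-elim ∘ ¬a) (⊥-elim ∘ ¬b)

module Polygon (m : ℕ) where

  n : ℕ
  n = suc m

  data SuccStep : ℕ → ℕ → Set where
    wrap : SuccStep m 0
    step : ∀ {x} → x < m → SuccStep x (suc x)

  inside-step : ∀ {a a' b b' x x'} → SuccStep a a' → SuccStep b b' → SuccStep x x' →
    InsideN a b x ⇔ InsideN a' b' x'
  inside-step (step _) (step _) (step _) = inside-shift
  inside-step wrap (step b<m) (step x<m) = inside-wrap x<m b<m
  inside-step (step a<m) wrap (step x<m) =
    ⇔-trans inside-cycle²⇔ (⇔-trans (inside-wrap a<m x<m) (⇔-sym inside-cycle²⇔))
  inside-step (step a<m) (step b<m) wrap =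
    ⇔-trans inside-cycle⇔ (⇔-trans (inside-wrap b<m a<m) (⇔-sym inside-cycle⇔))
  inside-step wrap wrap _ = both-absurd inside-empty inside-empty
  inside-step wrap (step _) wrap =
    both-absurd (inside-empty ∘ inside-cycle) (inside-empty ∘ inside-cycle)
  inside-step (step _) wrap wrap =
    both-absurd (inside-empty ∘ inside-cycle ∘ inside-cycle)
                (inside-empty ∘ inside-cycle ∘ inside-cycle)

  infix 4 _≋_
  _≋_ : ℕ → ℕ → Set
  x ≋ y = x % n ≡ y % n

  ≋-+ˡ : ∀ c {x y} → x ≋ y → c + x ≋ c + y
  ≋-+ˡ c {x} {y} x≋y = begin
    (c + x) % n            ≡⟨ %-distribˡ-+ c x n ⟩
    (c % n + x % n) % n    ≡⟨ cong (λ r → (c % n + r) % n) x≋y ⟩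
    (c % n + y % n) % n    ≡⟨ %-distribˡ-+ c y n ⟨
    (c + y) % n            ∎
    where open ≡-Reasoning

  ≋-+ʳ : ∀ c {x y} → x ≋ y → x + c ≋ y + c
  ≋-+ʳ c {x} {y} x≋y = subst₂ _≋_ (+-comm c x) (+-comm c y) (≋-+ˡ c x≋y)

  -- Cancelling 1: add m to both sides, x + n ≋ x.
  ≋-cancel-suc : ∀ {x y} → suc x ≋ suc y → x ≋ y
  ≋-cancel-suc {x} {y} e = begin
    x % n              ≡⟨ [m+n]%n≡m%n x n ⟨
    (x + n) % n        ≡⟨ cong (_% n) (plus-n x) ⟩
    (m + suc x) % n    ≡⟨ ≋-+ˡ m e ⟩
    (m + suc y) % n    ≡⟨ cong (_% n) (plus-n y) ⟨
    (y + n) % n        ≡⟨ [m+n]%n≡m%n y n ⟩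
    y % n              ∎
    where
    open ≡-Reasoning
    plus-n : ∀ z → z + n ≡ m + suc z
    plus-n z = trans (+-comm z n) (sym (+-suc m z))

  ≋-cancelˡ : ∀ c {x y} → c + x ≋ c + y → x ≋ y
  ≋-cancelˡ zero e = e
  ≋-cancelˡ (suc c) e = ≋-cancelˡ c (≋-cancel-suc e)

  ≋-cancelʳ : ∀ c {x y} → x + c ≋ y + c → x ≋ y
  ≋-cancelʳ c {x} {y} e = ≋-cancelˡ c (subst₂ _≋_ (+-comm x c) (+-comm y c) e)

  ≋-small : ∀ {x y} → x < n → y < n → x ≋ y → x ≡ y
  ≋-small x<n y<n e = trans (sym (m<n⇒m%n≡m x<n)) (trans e (m<n⇒m%n≡m y<n))

  offsets-differ : ∀ {p q x} → p < q → q ≤ m → ¬ (p + x ≋ q + x)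
  offsets-differ {p} {q} {x} p<q q≤m e =
    <-irrefl (≋-small (<-trans p<q (s≤s q≤m)) (s≤s q≤m) (≋-cancelʳ x {p} {q} e)) p<q

  isV⇒≋ : ∀ {a : Fin n} {k} → IsV n a k → k ≋ toℕ a
  isV⇒≋ {a} (q , refl) = [m+kn]%n≡m%n (toℕ a) q n

  ≋⇒isV : ∀ {a : Fin n} {k} → k ≋ toℕ a → IsV n a k
  ≋⇒isV {a} {k} e = k / n ,
    trans (m≡m%n+[m/n]*n k n) (cong (_+ k / n * n) (trans e (m<n⇒m%n≡m (toℕ<n a))))

  toℕ-mod : ∀ k → toℕ (k mod n) ≋ k
  toℕ-mod k = trans (cong (_% n) (toℕ-fromℕ< (m%n<n k n))) (m%n%n≡m%n k n)

  next : Fin n → Fin n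
  next x = suc (toℕ x) mod n

  next-≋ : ∀ x → toℕ (next x) ≋ suc (toℕ x)
  next-≋ x = toℕ-mod (suc (toℕ x))

  next-step : ∀ x → SuccStep (toℕ x) (toℕ (next x))
  next-step x with m≤n⇒m<n∨m≡n (≤-pred (toℕ<n x))
  ... | inj₁ x<m = subst (SuccStep (toℕ x))
          (sym (trans (toℕ-fromℕ< _) (m<n⇒m%n≡m (s<s x<m)))) (step x<m)
  ... | inj₂ x≡m = subst₂ SuccStep (sym x≡m)
          (sym (trans (toℕ-fromℕ< _) (trans (cong (λ k → suc k % n) x≡m) (n%n≡0 n)))) wrap

  next-surjective : ∀ y → Σ (Fin n) λ x → next x ≡ y
  next-surjective y = x , toℕ-injective (≋-small (toℕ<n (next x)) (toℕ<n y) next-x≋y)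
    where
    open ≡-Reasoning
    x : Fin n
    x = (toℕ y + m) mod n
    next-x≋y : toℕ (next x) ≋ toℕ y
    next-x≋y = begin
      toℕ (next x) % n         ≡⟨ next-≋ x ⟩
      suc (toℕ x) % n          ≡⟨ ≋-+ˡ 1 (toℕ-mod (toℕ y + m)) ⟩
      suc (toℕ y + m) % n      ≡⟨ cong (_% n) (+-suc (toℕ y) m) ⟨
      (toℕ y + n) % n          ≡⟨ [m+n]%n≡m%n (toℕ y) n ⟩
      toℕ y % n                ∎

  rotate : ℕ → Fin n → Fin n
  rotate zero x = x
  rotate (suc k) x = next (rotate k x)

  rotate-≋ : ∀ k x → toℕ (rotate k x) ≋ toℕ x + k
  rotate-≋ zero x = cong (_% n) (sym (+-comm (toℕ x) 0))
  rotate-≋ (suc k) x = trans (next-≋ (rotate k x))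
    (trans (≋-+ˡ 1 (rotate-≋ k x)) (cong (_% n) (sym (+-suc (toℕ x) k))))

  rotate-surjective : ∀ k y → Σ (Fin n) λ x → rotate k x ≡ y
  rotate-surjective zero y = y , refl
  rotate-surjective (suc k) y with next-surjective y
  ... | y' , refl with rotate-surjective k y'
  ...   | x , refl = x , refl

  inside-rotate : ∀ k a b x → Inside a b x ⇔ Inside (rotate k a) (rotate k b) (rotate k x)
  inside-rotate zero a b x = ⇔-refl
  inside-rotate (suc k) a b x = ⇔-trans (inside-rotate k a b x)
    (inside-step (next-step (rotate k a)) (next-step (rotate k b)) (next-step (rotate k x)))

  cross-preserved : (f : Fin n → Fin n) → (∀ a b x → Inside a b x ⇔ Inside (f a) (f b) (f x)) →
    ∀ a b c d → Cross a b c d ⇔ Cross (f a) (f b) (f c) (f d)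
  cross-preserved f F a b c d = (F a b c ×-⇔ F b a d) ⊎-⇔ (F b a c ×-⇔ F a b d)

  cross-rotate : ∀ k a b c d → Cross a b c d ⇔ Cross (rotate k a) (rotate k b) (rotate k c) (rotate k d)
  cross-rotate k = cross-preserved (rotate k) (inside-rotate k)

  -- b comes two corners after a: the chord ab is the span-2 edge centred at a + 1.
  TwoApart : Fin n → Fin n → Set
  TwoApart a b = toℕ b ≋ 2 + toℕ a

  next-twoApart : ∀ {a b} → TwoApart a b → TwoApart (next a) (next b)
  next-twoApart {a} {b} ab =
    trans (next-≋ b) (trans (≋-+ˡ 1 ab) (sym (≋-+ˡ 2 (next-≋ a))))

  rotate-twoApart : ∀ k {a b} → TwoApart a b → TwoApart (rotate k a) (rotate k b)
  rotate-twoApart zero ab = ab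
  rotate-twoApart (suc k) ab = next-twoApart (rotate-twoApart k ab)

  twoApart-diagonal : 3 ≤ m → ∀ {a b} → TwoApart a b → Diagonal n a b
  twoApart-diagonal 3≤m {a} {b} ab = distinct , not-side
    where
    2≤m : 2 ≤ m
    2≤m = ≤-trans (n≤1+n 2) 3≤m
    distinct : a ≢ b
    distinct refl = offsets-differ (s≤s z≤n) 2≤m ab
    -- a side {j, j+1} in either orientation forces 1 + j ≋ 2 + j or j ≋ 3 + j
    not-side : ¬ IsSide n a b
    not-side (j , inj₁ (va , vb)) =
      offsets-differ (s≤s (s≤s z≤n)) 2≤m (trans (isV⇒≋ vb) (trans ab (≋-+ˡ 2 (sym (isV⇒≋ va)))))
    not-side (j , inj₂ (vb , va)) =
      offsets-differ (s≤s z≤n) 3≤m (trans (isV⇒≋ vb) (trans ab (≋-+ˡ 2 (sym (isV⇒≋ va)))))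

  twoApart-span2 : ∀ {a b} → TwoApart a b → Σ (Fin n) λ t → IsSpan2 n a b (toℕ t)
  twoApart-span2 {a} {b} ab = next a , inj₁ (≋⇒isV before , ≋⇒isV (trans (≋-+ˡ 1 (next-≋ a)) (sym ab)))
    where
    open ≡-Reasoning
    before : toℕ (next a) + m ≋ toℕ a
    before = begin
      (toℕ (next a) + m) % n   ≡⟨ ≋-+ʳ m {toℕ (next a)} {suc (toℕ a)} (next-≋ a) ⟩
      (suc (toℕ a) + m) % n    ≡⟨ cong (_% n) (+-suc (toℕ a) m) ⟨
      (toℕ a + n) % n          ≡⟨ [m+n]%n≡m%n (toℕ a) n ⟩
      toℕ a % n                ∎

  -- … and, for n ≥ 5, at no other corner: any centre t satisfies t + 1 ≋ b.
  twoApart-centre : 4 ≤ m → ∀ {a b t} → TwoApart a b → IsSpan2 n a b t → suc t ≋ toℕ b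
  twoApart-centre _ _ (inj₁ (_ , vb)) = isV⇒≋ vb
  twoApart-centre 4≤m {a} {b} {t} ab (inj₂ (vb , va)) = ⊥-elim (offsets-differ 4≤m ≤-refl three≋m)
    where
    three≋m : 3 + t ≋ m + t
    three≋m = trans (≋-+ˡ 2 (isV⇒≋ va))
      (trans (sym ab) (trans (sym (isV⇒≋ vb)) (cong (_% n) (+-comm t m))))

Uncrossed : (ℕ → ℕ → Set) → ℕ → ℕ → Set
Uncrossed D a b = ∀ s t → D s t → ¬ CrossN a b s t

module Ears (m : ℕ) (D : ℕ → ℕ → Set)
  (D-sym : ∀ {p q} → D p q → D q p)
  (D-nonCrossing : ∀ {p q s t} → D p q → D s t → ¬ CrossN p q s t)
  (D-maximal : ∀ p → 2 + p ≤ m → Uncrossed D p (2 + p) → D p (2 + p)) where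

  NoEar : ℕ → ℕ → Set
  NoEar a b = ∀ j → a ≤ j → 2 + j ≤ b → ¬ D j (2 + j)

  crossing-ends-at : ∀ {a b' s t} → a < b' → Uncrossed D a (suc b') → D s t →
    InsideN a b' s → InsideN b' a t → a < s × s < b' × t ≡ suc b'
  crossing-ends-at a<b' _ _ (inj₂ (b'<a , _)) _ = ⊥-elim (<-asym a<b' b'<a)
  crossing-ends-at a<b' _ _ (inj₁ _) (inj₁ (b'<a , _)) = ⊥-elim (<-asym a<b' b'<a)
  crossing-ends-at {a} {b'} {s} {t} a<b' U Dst (inj₁ (_ , a<s , s<b')) (inj₂ (_ , t-out)) =
    a<s , s<b' , ends t-out
    where
    a<b : a < suc b'
    a<b = ≤-trans a<b' (n≤1+n b')
    s-in : InsideN a (suc b') s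
    s-in = inj₁ (a<b , a<s , ≤-trans s<b' (n≤1+n b'))
    ends : b' < t ⊎ t < a → t ≡ suc b'
    ends (inj₂ t<a) = ⊥-elim (U s t Dst (inj₁ (s-in , inj₂ (a<b , inj₂ t<a))))
    ends (inj₁ b'<t) with m≤n⇒m<n∨m≡n b'<t
    ... | inj₂ b≡t = sym b≡t
    ... | inj₁ b<t = ⊥-elim (U s t Dst (inj₁ (s-in , inj₂ (a<b , inj₁ b<t))))

  -- Induction on the fuel k ≥ b − a − 2: either b = a + 2 and maximality
  -- puts {a, b} itself in D, or {a, b − 1} is uncrossed (recurse) because a
  -- chord {s, b} crossing it bounds a shorter uncrossed chord (recurse there).
  ear : ∀ k a b → 2 + a ≤ b → b ≤ k + (2 + a) → b ≤ m → Uncrossed D a b → ¬ NoEar a b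
  ear k a b a+2≤b _ b≤m U noEar with m≤n⇒m<n∨m≡n a+2≤b
  ... | inj₂ refl = noEar a ≤-refl ≤-refl (D-maximal a b≤m U)
  ear zero a b _ b≤a+2 _ _ _ | inj₁ a+2<b = <-irrefl refl (≤-trans a+2<b b≤a+2)
  ear (suc k) a (suc b') _ bound b≤m U noEar | inj₁ a+2<b =
    ear k a b' (≤-pred a+2<b) (≤-pred bound) (≤-trans (n≤1+n b') b≤m) shorter
        (λ j a≤j j+2≤b' → noEar j a≤j (≤-trans j+2≤b' (n≤1+n b')))
    where
    a<b' : a < b'
    a<b' = ≤-trans (n≤1+n (suc a)) (≤-pred a+2<b)
    through-b : ∀ {s t} → D s t → InsideN a b' s → InsideN b' a t → ⊥
    through-b Dst s-in t-out with crossing-ends-at a<b' U Dst s-in t-out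
    ... | a<s , s<b' , refl =
      ear k _ (suc b') (s≤s s<b')
        (≤-trans bound (≤-trans (≤-reflexive (sym (+-suc k (2 + a)))) (+-monoʳ-≤ k (s≤s (s≤s a<s)))))
        b≤m (λ u v Duv → D-nonCrossing Dst Duv)
        (λ j s≤j j+2≤b → noEar j (≤-trans (<⇒≤ a<s) s≤j) j+2≤b)
    shorter : Uncrossed D a b'
    shorter s t Dst (inj₁ (s-in , t-out)) = through-b Dst s-in t-out
    shorter s t Dst (inj₂ (s-out , t-in)) = through-b (D-sym Dst) t-in s-out

-- The triangulation read in labels rotated by s = i + 1, under which the
-- permitted edges e_i, e_{i+1} wrap around the label m ↦ 0.
module RotatedTriangulation (m : ℕ) (4≤m : 4 ≤ m) (i : Fin (suc m)) {G : GeomGraph (suc m)}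
  (only-span2 : ∀ a b → Σ (Fin (suc m)) (λ j → IsSpan2 (suc m) a b (toℕ j)) → Edge G a b →
    IsSpan2 (suc m) a b (toℕ i) ⊎ IsSpan2 (suc m) a b (suc (toℕ i)))
  (T : Triangulation G) where

  open Polygon m
  open Triangulation T

  s : ℕ
  s = suc (toℕ i)

  ρ : Fin n → Fin n
  ρ = rotate s

  D : ℕ → ℕ → Set
  D p q = Σ (Fin n) λ c → Σ (Fin n) λ d → toℕ c ≡ p × toℕ d ≡ q × diag (ρ c) (ρ d) ≡ true

  D-sym : ∀ {p q} → D p q → D q p
  D-sym (c , d , c≡p , d≡q , cd) = d , c , d≡q , c≡p , trans (diag-sym (ρ d) (ρ c)) cd

  D-nonCrossing : ∀ {p q s t} → D p q → D s t → ¬ CrossN p q s t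
  D-nonCrossing (c , d , refl , refl , cd) (u , v , refl , refl , uv) cr =
    nonCrossing (ρ c) (ρ d) (ρ u) (ρ v) cd uv (Equivalence.to (cross-rotate s c d u v) cr)

  D-maximal : ∀ p → 2 + p ≤ m → Uncrossed D p (2 + p) → D p (2 + p)
  D-maximal p p+2≤m U = c , d , c≡p , d≡p+2 , maximal (ρ c) (ρ d) diagonal clear
    where
    p<n : p < n
    p<n = s≤s (≤-trans (n≤1+n p) (≤-trans (n≤1+n (suc p)) p+2≤m))
    c d : Fin n
    c = fromℕ< p<n
    d = fromℕ< (s≤s p+2≤m)
    c≡p : toℕ c ≡ p
    c≡p = toℕ-fromℕ< p<n
    d≡p+2 : toℕ d ≡ 2 + p
    d≡p+2 = toℕ-fromℕ< (s≤s p+2≤m)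
    diagonal : Diagonal n (ρ c) (ρ d)
    diagonal = twoApart-diagonal (≤-trans (n≤1+n 3) 4≤m)
      (rotate-twoApart s (cong (_% n) (trans d≡p+2 (cong (2 +_) (sym c≡p)))))
    clear : ∀ c' d' → diag c' d' ≡ true → ¬ Cross (ρ c) (ρ d) c' d'
    clear c' d' c'd' cr with rotate-surjective s c' | rotate-surjective s d'
    ... | x , refl | y , refl = U (toℕ x) (toℕ y) (x , y , refl , refl , c'd')
          (subst₂ (λ p' q' → CrossN p' q' (toℕ x) (toℕ y)) c≡p d≡p+2
            (Equivalence.from (cross-rotate s c d x y) cr))

  outer-side : Uncrossed D 0 m
  outer-side _ _ (_ , d , refl , refl , _) (inj₁ (_ , d-in)) = nothing-after-last (≤-pred (toℕ<n d)) d-in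
  outer-side _ _ (c , _ , refl , refl , _) (inj₂ (c-in , _)) = nothing-after-last (≤-pred (toℕ<n c)) c-in

  -- No chord {j, j+2} of the rotated polygon lies in G: its centre is the
  -- rotated label j + 1, which is neither i nor i + 1 in the original labels.
  no-ear : ∀ j → 2 + j ≤ m → ¬ D j (2 + j)
  no-ear _ j+2≤m (c , d , refl , d≡ , cd) =
    excluded (only-span2 (ρ c) (ρ d) (twoApart-span2 apart) (inG (ρ c) (ρ d) cd))
    where
    apart : TwoApart (ρ c) (ρ d)
    apart = rotate-twoApart s (cong (_% n) d≡)
    ρd≋ : toℕ (ρ d) ≋ (2 + toℕ c) + s
    ρd≋ = trans (rotate-≋ s d) (cong (λ k → (k + s) % n) d≡)
    excluded : ¬ (IsSpan2 n (ρ c) (ρ d) (toℕ i) ⊎ IsSpan2 n (ρ c) (ρ d) (suc (toℕ i)))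
    excluded (inj₁ at-i) = offsets-differ z<s j+2≤m (trans (twoApart-centre 4≤m apart at-i) ρd≋)
    excluded (inj₂ at-i+1) =
      offsets-differ (s≤s (s≤s z≤n)) j+2≤m (trans (twoApart-centre 4≤m apart at-i+1) ρd≋)

proposition2 : (n : ℕ) → 5 ≤ n → (i : Fin n) → (G : GeomGraph n) →
    (∀ a b → Σ (Fin n) (λ j → IsSpan2 n a b (toℕ j)) →
      (Edge G a b ⇔ (IsSpan2 n a b (toℕ i) ⊎ IsSpan2 n a b (suc (toℕ i))))) →
    ¬ Triangulation G
proposition2 zero () i G hyp T
proposition2 (suc m) (s≤s 4≤m) i G hyp T =
  ear m 0 m 2≤m (m≤m+n m 2) ≤-refl outer-side (λ j _ → no-ear j)
  where
  open RotatedTriangulation m 4≤m i (λ a b span2 → Equivalence.to (hyp a b span2)) T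
  open Ears m D D-sym D-nonCrossing D-maximal
  2≤m : 2 ≤ m
  2≤m = ≤-trans (s≤s (s≤s z≤n)) 4≤m
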